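{- Let $G$ be a $(d,k)$-digraph and let $\varphi$ be an automorphism of $G$. If $u$ and $v$ are two distinct vertices fixed by $\varphi$, then every walk of length at most $k$ from $u$ to $v$ is fixed by $\varphi^2$ (i.e., $\varphi^2$ maps it onto itself, vertex by vertex).
   Context: A $(d,k)$-digraph (almost Moore digraph) is a finite digraph, diregular of degree $d>1$ (every vertex has in- and out-degree $d$), of diameter $k>1$ and order $N=d+d^2+\cdots+d^k$. In such a digraph every vertex $v$ has a unique vertex $r(v)$ (its repeat) such that there are exactly two walks of length $\leq k$ from $v$ to $r(v)$, at least one of them of length $k$, while for every $w\neq r(v)$ there is exactly one walk of length $\leq k$ from $v$ to $w$. -}

module Defs where

open import Data.Nat using (ℕ; zero; suc; _+_; _^_; _≤_; _<_; _∸_)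
open import Data.Bool using (Bool; true; false; if_then_else_)
open import Data.Fin using (Fin; zero; suc; inject₁; fromℕ)
open import Data.Fin.Permutation using (Permutation′; _⟨$⟩ʳ_)
open import Data.Product using (Σ; _×_; ∃; ∃-syntax; _,_)
open import Relation.Binary.PropositionalEquality using (_≡_)
open import Relation.Nullary using (¬_)

-- A finite digraph (no multiple arcs; loops allowed) on vertex set Fin n,
-- given by its adjacency relation: adj u v ≡ true iff (u , v) is an arc.
record Digraph : Set where
  field
    n   : ℕ
    adj : Fin n → Fin n → Bool
open Digraph public

count : ∀ {m} → (Fin m → Bool) → ℕ
count {zero}  p = 0
count {suc m} p = (if p zero then 1 else 0) + count (λ i → p (suc i))

outdeg : (G : Digraph) → Fin (n G) → ℕ
outdeg G u = count (λ v → adj G u v)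

indeg : (G : Digraph) → Fin (n G) → ℕ
indeg G v = count (λ u → adj G u v)

record Walk (G : Digraph) (ℓ : ℕ) (u v : Fin (n G)) : Set where
  field
    vtx   : Fin (suc ℓ) → Fin (n G)
    start : vtx zero ≡ u
    end   : vtx (fromℕ ℓ) ≡ v
    arcs  : (i : Fin ℓ) → adj G (vtx (inject₁ i)) (vtx (suc i)) ≡ true
open Walk public

Reach≤ : (G : Digraph) → ℕ → Fin (n G) → Fin (n G) → Set
Reach≤ G m u v = Σ ℕ λ ℓ → ℓ ≤ m × Walk G ℓ u v

HasDiameter : Digraph → ℕ → Set
HasDiameter G k =
  ((u v : Fin (n G)) → Reach≤ G k u v) ×
  (∃[ u ] ∃[ v ] ¬ Reach≤ G (k ∸ 1) u v)

mooreSum : ℕ → ℕ → ℕ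
mooreSum d zero    = 0
mooreSum d (suc k) = mooreSum d k + d ^ suc k

IsAlmostMoore : Digraph → ℕ → ℕ → Set
IsAlmostMoore G d k =
  1 < d × 1 < k ×
  ((u : Fin (n G)) → outdeg G u ≡ d × indeg G u ≡ d) ×
  HasDiameter G k ×
  n G ≡ mooreSum d k

IsAutomorphism : (G : Digraph) → Permutation′ (n G) → Set
IsAutomorphism G φ =
  (u v : Fin (n G)) → adj G (φ ⟨$⟩ʳ u) (φ ⟨$⟩ʳ v) ≡ adj G u v

{-# OPTIONS --safe #-}
module Submission where

-- Let T(u,y) count the walks of length at most k from u to y, the trivial walk included.
-- Out-regularity gives ∑_y T(u,y) = 1 + d + ⋯ + d^k = 1 + |V|, while T(u,y) ≥ 1 for every y
-- because the diameter is k; hence T(u,v) ≤ 2.  If φ² moved the i-th vertex x of a walk w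
-- from u to v, then x, φ x, φ² x would be pairwise distinct, so w, φ∘w and φ²∘w would be
-- three walks from u to v differing at position i, and T(u,v) ≥ 3.

open import Defs
open import Data.Bool using (Bool; true; false; if_then_else_)
open import Data.Fin using (Fin; zero; suc; punchIn; punchOut)
open import Data.Fin.Permutation using (Permutation′; _⟨$⟩ʳ_)
open import Data.Fin.Properties using (_≟_; punchIn-punchOut; punchOut-injective)
open import Data.Nat using (ℕ; zero; suc; _+_; _*_; _^_; _≤_; _≤′_; ≤′-refl; ≤′-step; z≤n)
open import Data.Nat.Properties
  using (+-*-semiring; ≤-refl; ≤-reflexive; ≤-trans; ≤-pred; m≤m+n; m≤n+m; +-mono-≤; +-monoʳ-≤; +-suc; +-assoc; +-identityʳ;
         ≤⇒≤′; ≰⇒>; ≤⇒≯; 1+n≰n; module ≤-Reasoning)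
open import Data.Product using (_,_; proj₁)
open import Data.Vec.Functional using (removeAt)
open import Function using (_∘_)
open import Function.Bundles using (Injection)
open import Function.Properties.Inverse using (↔⇒↣)
open import Relation.Binary.PropositionalEquality using (_≡_; _≢_; refl; sym; trans; cong; cong₂; module ≡-Reasoning)
open import Relation.Nullary using (does; yes; no; contradiction)
open import Relation.Nullary.Decidable using (dec-true)

open import Algebra.Properties.Semiring.Sum +-*-semiring
  using (sum; sum-cong-≗; sum-remove; ∑-comm; ∑-distrib-+; sum-replicate-zero)

sum-if : ∀ {m} (b : Bool) (g : Fin m → ℕ) → sum (λ i → if b then g i else 0) ≡ (if b then sum g else 0)
sum-if     true  g = refl
sum-if {m} false g = sum-replicate-zero m

sum-if-const : ∀ {m} (p : Fin m → Bool) (c : ℕ) → sum (λ i → if p i then c else 0) ≡ count p * c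
sum-if-const {zero}  p c = refl
sum-if-const {suc m} p c with p zero
... | true  = cong (c +_) (sum-if-const (p ∘ suc) c)
... | false = sum-if-const (p ∘ suc) c

sum-indicator : ∀ {m} (u : Fin m) (c : ℕ) → sum (λ v → if does (u ≟ v) then c else 0) ≡ c
sum-indicator {suc m} zero    c = trans (cong (c +_) (sum-replicate-zero m)) (+-identityʳ c)
sum-indicator {suc m} (suc u) c = sum-indicator u c

term≤sum : ∀ {m} (f : Fin m → ℕ) (i : Fin m) → f i ≤ sum f
term≤sum f zero    = m≤m+n _ _
term≤sum f (suc i) = ≤-trans (term≤sum (f ∘ suc) i) (m≤n+m _ _)

term₂≤sum : ∀ {m} (f : Fin m → ℕ) {i j : Fin m} → i ≢ j → f i + f j ≤ sum f
term₂≤sum {zero}  f {()}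
term₂≤sum {suc m} f {i} {j} i≢j = begin
  f i + f j                          ≡⟨ cong (λ x → f i + f x) (sym (punchIn-punchOut i≢j)) ⟩
  f i + removeAt f i (punchOut i≢j)  ≤⟨ +-monoʳ-≤ (f i) (term≤sum (removeAt f i) _) ⟩
  f i + sum (removeAt f i)           ≡⟨ sum-remove f ⟨
  sum f                              ∎
  where open ≤-Reasoning

term₃≤sum : ∀ {m} (f : Fin m → ℕ) {i j k : Fin m} → i ≢ j → i ≢ k → j ≢ k → f i + f j + f k ≤ sum f
term₃≤sum {zero}  f {()}
term₃≤sum {suc m} f {i} {j} {k} i≢j i≢k j≢k = begin
  f i + f j + f k                             ≡⟨ +-assoc (f i) (f j) (f k) ⟩
  f i + (f j + f k)                           ≡⟨ cong₂ (λ x y → f i + (f x + f y)) (sym (punchIn-punchOut i≢j))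
                                                                                   (sym (punchIn-punchOut i≢k)) ⟩
  f i + (g (punchOut i≢j) + g (punchOut i≢k)) ≤⟨ +-monoʳ-≤ (f i) (term₂≤sum g (j≢k ∘ punchOut-injective i≢j i≢k)) ⟩
  f i + sum g                                 ≡⟨ sum-remove f ⟨
  sum f                                       ∎
  where
  open ≤-Reasoning
  g : Fin m → ℕ
  g = removeAt f i

sum-positive : ∀ {m} (f : Fin m → ℕ) → (∀ i → 1 ≤ f i) → m ≤ sum f
sum-positive {zero}  f pos = z≤n
sum-positive {suc m} f pos = +-mono-≤ (pos zero) (sum-positive (f ∘ suc) (pos ∘ suc))

sum-positive-excess : ∀ {m e} (f : Fin m → ℕ) {v : Fin m} → (∀ i → 1 ≤ f i) → suc e ≤ f v → e + m ≤ sum f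
sum-positive-excess {zero}      f {()}
sum-positive-excess {suc m} {e} f {v} pos e<fv = begin
  e + suc m                ≡⟨ +-suc e m ⟩
  suc e + m                ≤⟨ +-mono-≤ e<fv (sum-positive (removeAt f v) (pos ∘ punchIn v)) ⟩
  f v + sum (removeAt f v) ≡⟨ sum-remove f ⟨
  sum f                    ∎
  where open ≤-Reasoning

module WalkCounting (G : Digraph) where

  V : Set
  V = Fin (n G)

  ∑out : V → (V → ℕ) → ℕ
  ∑out u g = sum (λ x → if adj G u x then g x else 0)

  ∑out-cong : ∀ u {g h : V → ℕ} → (∀ x → g x ≡ h x) → ∑out u g ≡ ∑out u h
  ∑out-cong u g≗h = sum-cong-≗ (λ x → cong (λ t → if adj G u x then t else 0) (g≗h x))

  ∑out-const : ∀ u c → ∑out u (λ _ → c) ≡ outdeg G u * c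
  ∑out-const u = sum-if-const (adj G u)

  ∑-∑out : ∀ u (h : V → V → ℕ) → sum (λ v → ∑out u (λ x → h x v)) ≡ ∑out u (λ x → sum (h x))
  ∑-∑out u h = trans (∑-comm (λ v x → if adj G u x then h x v else 0)) (sum-cong-≗ (λ x → sum-if (adj G u x) (h x)))

  term≤∑out : ∀ {u x} (g : V → ℕ) → adj G u x ≡ true → g x ≤ ∑out u g
  term≤∑out {u} {x} g ux = ≤-trans (≤-reflexive (cong (λ b → if b then g x else 0) (sym ux))) (term≤sum _ x)

  walks : ℕ → V → V → ℕ
  walks zero    u v = if does (u ≟ v) then 1 else 0
  walks (suc ℓ) u v = ∑out u (λ x → walks ℓ x v)

  walksUpTo : ℕ → V → V → ℕ
  walksUpTo zero    u v = walks zero u v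
  walksUpTo (suc k) u v = walksUpTo k u v + walks (suc k) u v

  walksVia : (ℓ : ℕ) → Fin (suc ℓ) → V → V → V → ℕ
  walksVia ℓ       zero    u x v = if does (u ≟ x) then walks ℓ u v else 0
  walksVia (suc ℓ) (suc i) u x v = ∑out u (λ y → walksVia ℓ i y x v)

  sum-walks : ∀ {d} → (∀ u → outdeg G u ≡ d) → ∀ ℓ u → sum (walks ℓ u) ≡ d ^ ℓ
  sum-walks out zero    u = sum-indicator u 1
  sum-walks {d} out (suc ℓ) u = begin
    sum (λ v → ∑out u (λ x → walks ℓ x v)) ≡⟨ ∑-∑out u (walks ℓ) ⟩
    ∑out u (λ x → sum (walks ℓ x))         ≡⟨ ∑out-cong u (sum-walks out ℓ) ⟩
    ∑out u (λ _ → d ^ ℓ)                   ≡⟨ ∑out-const u (d ^ ℓ) ⟩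
    outdeg G u * d ^ ℓ                     ≡⟨ cong (_* d ^ ℓ) (out u) ⟩
    d * d ^ ℓ                              ∎
    where open ≡-Reasoning

  sum-walksUpTo : ∀ {d} → (∀ u → outdeg G u ≡ d) → ∀ k u → sum (walksUpTo k u) ≡ suc (mooreSum d k)
  sum-walksUpTo out zero    u = sum-walks out zero u
  sum-walksUpTo out (suc k) u =
    trans (∑-distrib-+ (walksUpTo k u) (walks (suc k) u))
          (cong₂ _+_ (sum-walksUpTo out k u) (sum-walks out (suc k) u))

  sum-walksVia : ∀ ℓ i u v → sum (λ x → walksVia ℓ i u x v) ≡ walks ℓ u v
  sum-walksVia ℓ       zero    u v = sum-indicator u (walks ℓ u v)
  sum-walksVia (suc ℓ) (suc i) u v =
    trans (∑-∑out u (λ y x → walksVia ℓ i y x v)) (∑out-cong u (λ y → sum-walksVia ℓ i y v))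

  walks≤walksUpTo : ∀ {ℓ k u v} → ℓ ≤′ k → walks ℓ u v ≤ walksUpTo k u v
  walks≤walksUpTo {zero}  ≤′-refl    = ≤-refl
  walks≤walksUpTo {suc ℓ} ≤′-refl    = m≤n+m _ _
  walks≤walksUpTo         (≤′-step p) = ≤-trans (walks≤walksUpTo p) (m≤m+n _ _)

  walkTail : ∀ {ℓ u v} (w : Walk G (suc ℓ) u v) → Walk G ℓ (vtx w (suc zero)) v
  walkTail w = record { vtx = vtx w ∘ suc ; start = refl ; end = end w ; arcs = arcs w ∘ suc }

  walkFirstArc : ∀ {ℓ u v} (w : Walk G (suc ℓ) u v) → adj G u (vtx w (suc zero)) ≡ true
  walkFirstArc w rewrite sym (start w) = arcs w zero

  walk⇒1≤walks : ∀ {ℓ u v} → Walk G ℓ u v → 1 ≤ walks ℓ u v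
  walk⇒1≤walks {zero} {u} {v} w rewrite dec-true (u ≟ v) (trans (sym (start w)) (end w)) = ≤-refl
  walk⇒1≤walks {suc ℓ} w =
    ≤-trans (walk⇒1≤walks (walkTail w)) (term≤∑out (λ x → walks ℓ x _) (walkFirstArc w))

  walk⇒1≤walksVia : ∀ {ℓ u v} (w : Walk G ℓ u v) (i : Fin (suc ℓ)) → 1 ≤ walksVia ℓ i u (vtx w i) v
  walk⇒1≤walksVia {u = u} w zero rewrite dec-true (u ≟ vtx w zero) (sym (start w)) = walk⇒1≤walks w
  walk⇒1≤walksVia {suc ℓ} w (suc i) =
    ≤-trans (walk⇒1≤walksVia (walkTail w) i) (term≤∑out (λ y → walksVia ℓ i y _ _) (walkFirstArc w))

  apart⇒3≤walks : ∀ {ℓ u v} (a b c : Walk G ℓ u v) (i : Fin (suc ℓ)) →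
                  vtx a i ≢ vtx b i → vtx a i ≢ vtx c i → vtx b i ≢ vtx c i → 3 ≤ walks ℓ u v
  apart⇒3≤walks {ℓ} {u} {v} a b c i a≢b a≢c b≢c = begin
    3                                             ≤⟨ +-mono-≤ (+-mono-≤ (walk⇒1≤walksVia a i) (walk⇒1≤walksVia b i))
                                                              (walk⇒1≤walksVia c i) ⟩
    via (vtx a i) + via (vtx b i) + via (vtx c i) ≤⟨ term₃≤sum via a≢b a≢c b≢c ⟩
    sum via                                       ≡⟨ sum-walksVia ℓ i u v ⟩
    walks ℓ u v                                   ∎
    where
    open ≤-Reasoning
    via : V → ℕ
    via x = walksVia ℓ i u x v

  reach⇒1≤walksUpTo : ∀ {k u v} → Reach≤ G k u v → 1 ≤ walksUpTo k u v
  reach⇒1≤walksUpTo (ℓ , ℓ≤k , w) = ≤-trans (walk⇒1≤walks w) (walks≤walksUpTo (≤⇒≤′ ℓ≤k))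

  walksUpTo≤2 : ∀ {d k} → (∀ u → outdeg G u ≡ d) → (∀ u v → Reach≤ G k u v) → n G ≡ mooreSum d k →
                ∀ u v → walksUpTo k u v ≤ 2
  walksUpTo≤2 {d} {k} out reach n≡ u v = ≤-pred (≰⇒> λ 3≤T → 1+n≰n (≤-pred (begin
    2 + n G                  ≤⟨ sum-positive-excess (walksUpTo k u) (reach⇒1≤walksUpTo ∘ reach u) 3≤T ⟩
    sum (walksUpTo k u)      ≡⟨ sum-walksUpTo out k u ⟩
    suc (mooreSum d k)       ≡⟨ cong suc n≡ ⟨
    suc (n G)                ∎)))
    where open ≤-Reasoning

open WalkCounting

mapWalk : ∀ {G ℓ u v u′ v′} (φ : Permutation′ (n G)) → IsAutomorphism G φ →
          φ ⟨$⟩ʳ u ≡ u′ → φ ⟨$⟩ʳ v ≡ v′ → Walk G ℓ u v → Walk G ℓ u′ v′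
mapWalk φ aut φu φv w = record
  { vtx   = (φ ⟨$⟩ʳ_) ∘ vtx w
  ; start = trans (cong (φ ⟨$⟩ʳ_) (start w)) φu
  ; end   = trans (cong (φ ⟨$⟩ʳ_) (end w)) φv
  ; arcs  = λ i → trans (aut _ _) (arcs w i)
  }

lemma1 : (G : Digraph) (d k : ℕ) → IsAlmostMoore G d k →
    (φ : Permutation′ (n G)) → IsAutomorphism G φ →
    (u v : Fin (n G)) → u ≢ v → φ ⟨$⟩ʳ u ≡ u → φ ⟨$⟩ʳ v ≡ v →
    (ℓ : ℕ) → ℓ ≤ k → (w : Walk G ℓ u v) →
    (i : Fin (suc ℓ)) → φ ⟨$⟩ʳ (φ ⟨$⟩ʳ (vtx w i)) ≡ vtx w i
lemma1 G d k (_ , _ , degrees , (reach , _) , n≡) φ aut u v _ φu φv ℓ ℓ≤k w i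
  with φ ⟨$⟩ʳ (φ ⟨$⟩ʳ (vtx w i)) ≟ vtx w i
... | yes fixed = fixed
... | no moved  = contradiction (≤-trans three-walks (walks≤walksUpTo G (≤⇒≤′ ℓ≤k)))
                                (≤⇒≯ (walksUpTo≤2 G (proj₁ ∘ degrees) reach n≡ u v))
  where
  φw φ²w : Walk G ℓ u v
  φw  = mapWalk φ aut φu φv w
  φ²w = mapWalk φ aut φu φv φw
  x≢φx : vtx w i ≢ φ ⟨$⟩ʳ vtx w i
  x≢φx x≡φx = moved (trans (cong (φ ⟨$⟩ʳ_) (sym x≡φx)) (sym x≡φx))
  three-walks : 3 ≤ walks G ℓ u v
  three-walks = apart⇒3≤walks G w φw φ²w i x≢φx (moved ∘ sym) (x≢φx ∘ Injection.injective (↔⇒↣ φ))
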